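{- Every closed typable term $M$ of $T^{\oplus}$ is positively almost-surely terminating, i.e. its average reduction length $\mathrm{AvLength}(M)$ is finite.
   Context: Types: $\sigma,\tau::=\mathbb N\mid\sigma\to\tau\mid\sigma\times\tau$. $T^{\oplus}$ terms: $M,N::=x\mid\lambda x.M\mid M\,N\mid\langle M,N\rangle\mid\pi_1\mid\pi_2\mid\mathtt{rec}\mid\mathtt 0\mid\mathtt S\mid M\oplus N$ (triples abbreviate nested pairs), simply typed with $\mathtt 0:\mathbb N$, $\mathtt S:\mathbb N\to\mathbb N$, $\mathtt{rec}:(\sigma\times(\mathbb N\to\sigma\to\sigma)\times\mathbb N)\to\sigma$, $\pi_1:(\sigma\times\tau)\to\sigma$, $\pi_2:(\sigma\times\tau)\to\tau$, and $M\oplus N:\sigma$ whenever $M,N:\sigma$. Numerals $\mathbf 0=\mathtt 0$, $\mathbf{n+1}=\mathtt S\mathbf n$. Values: closed terms of $V,W::=\lambda x.M\mid\pi_1\mid\pi_2\mid\langle V,W\rangle\mid\mathtt{rec}\mid\mathtt 0\mid\mathtt S\mid\mathtt S\,V$. Distributions: $\mu:A\to[0,1]$ with mass $\le1$; $\{M\}$ Dirac; $C[\mu]$ pushforward. Weak call-by-value one-step reduction: $(\lambda x.M)V\to\{M[V/x]\}$; if $M\to\mu$ then $MV\to\mu V$; if $N\to\nu$ then $MN\to M\nu$; pairs reduce left then right; $\mathtt{rec}\langle U,V,\mathtt 0\rangle\to\{U\}$; $\mathtt{rec}\langle U,V,\mathtt S\mathbf n\rangle\to\{V\,\mathbf n\,(\mathtt{rec}\langle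 U,V,\mathbf n\rangle)\}$; $\pi_1\langle V,U\rangle\to\{V\}$; $\pi_2\langle V,U\rangle\to\{U\}$; $M\oplus N\to\frac12\{M\}+\frac12\{N\}$; lifted to distributions by reducing each reducible term in the support and keeping values. For closed $M$: $\mu_0=\{M\}$, $\mu_{k+1}$ the reduct of $\mu_k$; $\mathrm{AvLength}(M)=\sum_{k\ge1}k\cdot\sum_{V}(\mu_k(V)-\mu_{k-1}(V))\in\mathbb N\cup\{+\infty\}$ (sum over values $V$). -}

module Defs where

open import Data.Nat using (ℕ; zero; suc; _<ᵇ_; _≡ᵇ_; pred)
open import Data.Bool using (Bool; true; false; _∧_; if_then_else_)
open import Data.List using (List; []; _∷_; _++_; map)
open import Data.Maybe using (Maybe; just; nothing)
open import Data.Product using (_×_; _,_)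
open import Data.Rational using (ℚ; 0ℚ; 1ℚ; ½; _+_; _*_; _-_)
import Data.Rational as Q
open import Data.Integer using (+_)

data Ty : Set where
  nat  : Ty
  _⇒_  : Ty → Ty → Ty
  _⊗_  : Ty → Ty → Ty

infixr 7 _⇒_
infixr 8 _⊗_

data Tm : Set where
  var  : ℕ → Tm
  lam  : Tm → Tm
  app  : Tm → Tm → Tm
  pair : Tm → Tm → Tm
  π₁   : Tm
  π₂   : Tm
  rec  : Tm
  zer  : Tm
  suc′ : Tm
  _⊕_  : Tm → Tm → Tm

triple : Tm → Tm → Tm → Tm
triple U V W = pair U (pair V W)

Ctx : Set
Ctx = List Ty

data _∋_∶_ : Ctx → ℕ → Ty → Set where
  here  : ∀ {Γ σ} → (σ ∷ Γ) ∋ zero ∶ σ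
  there : ∀ {Γ σ τ n} → Γ ∋ n ∶ σ → (τ ∷ Γ) ∋ suc n ∶ σ

data _⊢_∶_ : Ctx → Tm → Ty → Set where
  ⊢var  : ∀ {Γ n σ} → Γ ∋ n ∶ σ → Γ ⊢ var n ∶ σ
  ⊢lam  : ∀ {Γ M σ τ} → (σ ∷ Γ) ⊢ M ∶ τ → Γ ⊢ lam M ∶ (σ ⇒ τ)
  ⊢app  : ∀ {Γ M N σ τ} → Γ ⊢ M ∶ (σ ⇒ τ) → Γ ⊢ N ∶ σ → Γ ⊢ app M N ∶ τ
  ⊢pair : ∀ {Γ M N σ τ} → Γ ⊢ M ∶ σ → Γ ⊢ N ∶ τ → Γ ⊢ pair M N ∶ (σ ⊗ τ)
  ⊢π₁   : ∀ {Γ σ τ} → Γ ⊢ π₁ ∶ ((σ ⊗ τ) ⇒ σ)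
  ⊢π₂   : ∀ {Γ σ τ} → Γ ⊢ π₂ ∶ ((σ ⊗ τ) ⇒ τ)
  ⊢rec  : ∀ {Γ σ} → Γ ⊢ rec ∶ ((σ ⊗ ((nat ⇒ σ ⇒ σ) ⊗ nat)) ⇒ σ)
  ⊢zer  : ∀ {Γ} → Γ ⊢ zer ∶ nat
  ⊢suc  : ∀ {Γ} → Γ ⊢ suc′ ∶ (nat ⇒ nat)
  ⊢⊕    : ∀ {Γ M N σ} → Γ ⊢ M ∶ σ → Γ ⊢ N ∶ σ → Γ ⊢ (M ⊕ N) ∶ σ

isValue : Tm → Bool
isValue (lam _)         = true
isValue π₁              = true
isValue π₂              = true
isValue (pair V W)      = isValue V ∧ isValue W
isValue rec             = true
isValue zer             = true
isValue suc′            = true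
isValue (app suc′ V)    = isValue V
isValue _               = false

shift : ℕ → Tm → Tm
shift c (var n)    = if n <ᵇ c then var n else var (suc n)
shift c (lam M)    = lam (shift (suc c) M)
shift c (app M N)  = app (shift c M) (shift c N)
shift c (pair M N) = pair (shift c M) (shift c N)
shift c (M ⊕ N)    = shift c M ⊕ shift c N
shift c t          = t

substAt : ℕ → Tm → Tm → Tm
substAt k V (var n)    = if n ≡ᵇ k then V else (if n <ᵇ k then var n else var (pred n))
substAt k V (lam M)    = lam (substAt (suc k) (shift zero V) M)
substAt k V (app M N)  = app (substAt k V M) (substAt k V N)
substAt k V (pair M N) = pair (substAt k V M) (substAt k V N)
substAt k V (M ⊕ N)    = substAt k V M ⊕ substAt k V N
substAt k V t          = t

-- Finite (sub)distributions: weighted lists (duplicates allowed; the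
-- weight of a term is the sum of its entries).
Dist : Set
Dist = List (Tm × ℚ)

dirac : Tm → Dist
dirac M = (M , 1ℚ) ∷ []

push : (Tm → Tm) → Dist → Dist
push C = map (λ { (M , p) → (C M , p) })

scale : ℚ → Dist → Dist
scale q = map (λ { (M , p) → (M , q * p) })

redex : Tm → Tm → Maybe Dist
redex (lam M) V = just (dirac (substAt zero V M))
redex π₁ (pair V U) = just (dirac V)
redex π₂ (pair V U) = just (dirac U)
redex rec (pair U (pair V zer)) = just (dirac U)
redex rec (pair U (pair V (app suc′ n))) =
  just (dirac (app (app V n) (app rec (triple U V n))))
redex _ _ = nothing

mapM : (Tm → Tm) → Maybe Dist → Maybe Dist
mapM C (just μ) = just (push C μ)
mapM C nothing  = nothing

-- weak call-by-value one-step reduction  M → μ  (nothing: no reduct,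
-- i.e. M is a value or stuck)
step : Tm → Maybe Dist
step (app M N) =
  if isValue N
  then (if isValue M then redex M N else mapM (λ X → app X N) (step M))
  else mapM (λ X → app M X) (step N)
step (pair M N) =
  if isValue M
  then mapM (λ X → pair M X) (step N)
  else mapM (λ X → pair X N) (step M)
step (M ⊕ N) = just ((M , ½) ∷ (N , ½) ∷ [])
step _ = nothing

stepD : Dist → Dist
stepD [] = []
stepD ((M , p) ∷ μ) with step M
... | just ν  = scale p ν ++ stepD μ
... | nothing = (M , p) ∷ stepD μ

μ : Tm → ℕ → Dist
μ M zero    = dirac M
μ M (suc k) = stepD (μ M k)

valMass : Dist → ℚ
valMass [] = 0ℚ
valMass ((M , p) ∷ ν) = (if isValue M then p else 0ℚ) + valMass ν

avPartial : Tm → ℕ → ℚ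
avPartial M zero    = 0ℚ
avPartial M (suc n) =
  avPartial M n + ((+ suc n) Q./ 1) * (valMass (μ M (suc n)) - valMass (μ M n))

-- AvLength(M) < ∞ : the (nonnegative-term) series has bounded partial sums
AvLengthFinite : Tm → Set
AvLengthFinite M = Σ ℕ (λ B → ∀ n → avPartial M n Q.≤ ((+ B) Q./ 1))
  where open import Data.Product using (Σ)

-- Reducibility: a typed closed term reduces, along every probabilistic branch, to a reducible
-- value, where reducibility at function types quantifies over reducible arguments (Tait's
-- method; the case of rec is an induction on the numeral). Because distributions are finite,
-- the resulting reduction tree is finitely branching and well founded, hence of bounded height
-- D. Then μ_k = μ_D for all k ≥ D, so the partial sums of AvLength(M) are constant from D on
-- and thus bounded.
module Submission where

open import Defs
open import Data.Bool using (true; false; _∧_)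
open import Data.Integer using (+_; -[1+_]; ∣_∣; +≤+; -≤+)
import Data.Integer as ℤ
import Data.Integer.Properties as ℤₚ
open import Data.List using (List; []; _∷_; length)
open import Data.List.Relation.Unary.All using (All; []; _∷_)
open import Data.List.Relation.Unary.All.Properties using (++⁺)
open import Data.Maybe using (just; nothing)
open import Data.Maybe.Properties using (just-injective)
open import Data.Nat using (ℕ; zero; suc; pred; _<ᵇ_; _≡ᵇ_; _<_; _≤_; _+_; _∸_; _⊔_; z≤n; s≤s)
import Data.Nat.Properties as ℕₚ
import Data.Nat.Coprimality as Coprimality
open import Data.Product using (∃; ∃₂; _×_; _,_; proj₁; proj₂)
import Data.Rational as ℚ
open import Data.Rational using (ℚ; mkℚ; ↥_; *≤*)
import Data.Rational.Properties as ℚₚ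
open import Data.Sum using (inj₁; inj₂)
open import Function using (_∘_; flip)
open import Relation.Binary.PropositionalEquality
open import Relation.Binary.Definitions using (tri<; tri≈; tri>)

-- Scoping and substitution

data Scoped : ℕ → Tm → Set where
  var  : ∀ {k n} → n < k → Scoped k (var n)
  lam  : ∀ {k M} → Scoped (suc k) M → Scoped k (lam M)
  app  : ∀ {k M N} → Scoped k M → Scoped k N → Scoped k (app M N)
  pair : ∀ {k M N} → Scoped k M → Scoped k N → Scoped k (pair M N)
  _⊕_  : ∀ {k M N} → Scoped k M → Scoped k N → Scoped k (M ⊕ N)
  π₁   : ∀ {k} → Scoped k π₁
  π₂   : ∀ {k} → Scoped k π₂
  rec  : ∀ {k} → Scoped k rec
  zer  : ∀ {k} → Scoped k zer
  suc′ : ∀ {k} → Scoped k suc′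

Closed : Tm → Set
Closed = Scoped 0

Scoped-weaken : ∀ {m n M} → m ≤ n → Scoped m M → Scoped n M
Scoped-weaken m≤n (var x)    = var (ℕₚ.<-≤-trans x m≤n)
Scoped-weaken m≤n (lam s)    = lam (Scoped-weaken (s≤s m≤n) s)
Scoped-weaken m≤n (app s t)  = app (Scoped-weaken m≤n s) (Scoped-weaken m≤n t)
Scoped-weaken m≤n (pair s t) = pair (Scoped-weaken m≤n s) (Scoped-weaken m≤n t)
Scoped-weaken m≤n (s ⊕ t)    = Scoped-weaken m≤n s ⊕ Scoped-weaken m≤n t
Scoped-weaken m≤n π₁         = π₁
Scoped-weaken m≤n π₂         = π₂
Scoped-weaken m≤n rec        = rec
Scoped-weaken m≤n zer        = zer
Scoped-weaken m≤n suc′       = suc′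

<⇒<ᵇ≡true : ∀ {m n} → m < n → (m <ᵇ n) ≡ true
<⇒<ᵇ≡true {zero}  {suc n} _         = refl
<⇒<ᵇ≡true {suc m} {suc n} (s≤s m<n) = <⇒<ᵇ≡true m<n

≥⇒<ᵇ≡false : ∀ {m n} → n ≤ m → (m <ᵇ n) ≡ false
≥⇒<ᵇ≡false {m}     {zero}  _         = refl
≥⇒<ᵇ≡false {suc m} {suc n} (s≤s n≤m) = ≥⇒<ᵇ≡false n≤m

≡ᵇ-refl : ∀ n → (n ≡ᵇ n) ≡ true
≡ᵇ-refl zero    = refl
≡ᵇ-refl (suc n) = ≡ᵇ-refl n

<⇒≡ᵇ≡false : ∀ {m n} → m < n → (m ≡ᵇ n) ≡ false
<⇒≡ᵇ≡false {zero}  {suc n} _         = refl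
<⇒≡ᵇ≡false {suc m} {suc n} (s≤s m<n) = <⇒≡ᵇ≡false m<n

>⇒≡ᵇ≡false : ∀ {m n} → n < m → (m ≡ᵇ n) ≡ false
>⇒≡ᵇ≡false {suc m} {zero}  _         = refl
>⇒≡ᵇ≡false {suc m} {suc n} (s≤s n<m) = >⇒≡ᵇ≡false n<m

substAt-var< : ∀ {n k} W → n < k → substAt k W (var n) ≡ var n
substAt-var< W n<k rewrite <⇒≡ᵇ≡false n<k | <⇒<ᵇ≡true n<k = refl

substAt-var≡ : ∀ k W → substAt k W (var k) ≡ W
substAt-var≡ k W rewrite ≡ᵇ-refl k = refl

substAt-var> : ∀ {n k} W → k < n → substAt k W (var n) ≡ var (pred n)
substAt-var> W k<n rewrite >⇒≡ᵇ≡false k<n | ≥⇒<ᵇ≡false (ℕₚ.<⇒≤ k<n) = refl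

pred-<-cancel : ∀ {n m} → 0 < n → n < suc m → pred n < m
pred-<-cancel {suc n} _ (s≤s n<m) = n<m

-- just-above and far-above are told apart because only in the latter is pred n still above k.
data Position (n k : ℕ) : Set where
  below      : n < k → Position n k
  at         : n ≡ k → Position n k
  just-above : n ≡ suc k → Position n k
  far-above  : suc k < n → Position n k

position : ∀ n k → Position n k
position n k with ℕₚ.<-cmp n k
... | tri< n<k _ _ = below n<k
... | tri≈ _ n≡k _ = at n≡k
... | tri> _ _ k<n with ℕₚ.m≤n⇒m<n∨m≡n k<n
...   | inj₁ 1+k<n = far-above 1+k<n
...   | inj₂ 1+k≡n = just-above (sym 1+k≡n)

shift-Scoped : ∀ {n c M} → n ≤ c → Scoped n M → shift c M ≡ M
shift-Scoped {c = c} n≤c (var {n = m} m<n)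
  rewrite <⇒<ᵇ≡true {m} {c} (ℕₚ.<-≤-trans m<n n≤c) = refl
shift-Scoped n≤c (lam s)    = cong lam (shift-Scoped (s≤s n≤c) s)
shift-Scoped n≤c (app s t)  = cong₂ app (shift-Scoped n≤c s) (shift-Scoped n≤c t)
shift-Scoped n≤c (pair s t) = cong₂ pair (shift-Scoped n≤c s) (shift-Scoped n≤c t)
shift-Scoped n≤c (s ⊕ t)    = cong₂ _⊕_ (shift-Scoped n≤c s) (shift-Scoped n≤c t)
shift-Scoped n≤c π₁         = refl
shift-Scoped n≤c π₂         = refl
shift-Scoped n≤c rec        = refl
shift-Scoped n≤c zer        = refl
shift-Scoped n≤c suc′       = refl

shift-Closed : ∀ {M} → Closed M → shift 0 M ≡ M
shift-Closed = shift-Scoped z≤n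

substAt-Scoped : ∀ {n k M} W → n ≤ k → Scoped n M → substAt k W M ≡ M
substAt-Scoped W n≤k (var m<n)  = substAt-var< W (ℕₚ.<-≤-trans m<n n≤k)
substAt-Scoped W n≤k (lam s)    = cong lam (substAt-Scoped _ (s≤s n≤k) s)
substAt-Scoped W n≤k (app s t)  = cong₂ app (substAt-Scoped W n≤k s) (substAt-Scoped W n≤k t)
substAt-Scoped W n≤k (pair s t) = cong₂ pair (substAt-Scoped W n≤k s) (substAt-Scoped W n≤k t)
substAt-Scoped W n≤k (s ⊕ t)    = cong₂ _⊕_ (substAt-Scoped W n≤k s) (substAt-Scoped W n≤k t)
substAt-Scoped W n≤k π₁         = refl
substAt-Scoped W n≤k π₂         = refl
substAt-Scoped W n≤k rec        = refl
substAt-Scoped W n≤k zer        = refl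
substAt-Scoped W n≤k suc′       = refl

substAt-Closed : ∀ {k M} W → Closed M → substAt k W M ≡ M
substAt-Closed W = substAt-Scoped W z≤n

Scoped-substAt : ∀ {m k M V} → k ≤ m → Closed V → Scoped (suc m) M →
                           Scoped m (substAt k V M)
Scoped-substAt {k = k} {var n} {V} k≤m cV (var n<1+m) with position n k
... | below n<k rewrite substAt-var< V n<k = var (ℕₚ.<-≤-trans n<k k≤m)
... | at refl rewrite substAt-var≡ n V = Scoped-weaken z≤n cV
... | just-above refl rewrite substAt-var> {n} {k} V ℕₚ.≤-refl = var (ℕₚ.≤-pred n<1+m)
... | far-above 1+k<n rewrite substAt-var> {n} {k} V (ℕₚ.<-trans (ℕₚ.n<1+n k) 1+k<n) =
  var (pred-<-cancel (ℕₚ.<-≤-trans (s≤s z≤n) 1+k<n) n<1+m)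
Scoped-substAt {V = V} k≤m cV (lam s) rewrite shift-Closed cV =
  lam (Scoped-substAt (s≤s k≤m) cV s)
Scoped-substAt k≤m cV (app s t)  = app (Scoped-substAt k≤m cV s) (Scoped-substAt k≤m cV t)
Scoped-substAt k≤m cV (pair s t) = pair (Scoped-substAt k≤m cV s) (Scoped-substAt k≤m cV t)
Scoped-substAt k≤m cV (s ⊕ t)    = Scoped-substAt k≤m cV s ⊕ Scoped-substAt k≤m cV t
Scoped-substAt k≤m cV π₁         = π₁
Scoped-substAt k≤m cV π₂         = π₂
Scoped-substAt k≤m cV rec        = rec
Scoped-substAt k≤m cV zer        = zer
Scoped-substAt k≤m cV suc′       = suc′

substAt-comm : ∀ {W V} → Closed W → Closed V → ∀ k M →
               substAt k W (substAt (suc k) V M) ≡ substAt k V (substAt k W M)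
substAt-comm {W} {V} cW cV k (var n) with position n k
... | below n<k
  rewrite substAt-var< V (ℕₚ.<-trans n<k (ℕₚ.n<1+n k)) | substAt-var< W n<k
        | substAt-var< V n<k = refl
... | at refl
  rewrite substAt-var< V (ℕₚ.n<1+n n) | substAt-var≡ n W | substAt-Closed {n} V cW = refl
... | just-above refl
  rewrite substAt-var≡ (suc k) V | substAt-Closed {k} W cV | substAt-var> {suc k} {k} W ℕₚ.≤-refl
        | substAt-var≡ k V = refl
... | far-above 1+k<n
  rewrite substAt-var> {n} {suc k} V 1+k<n | substAt-var> {n} {k} W (ℕₚ.<-trans (ℕₚ.n<1+n k) 1+k<n)
        | substAt-var> {pred n} {k} W (ℕₚ.suc[m]≤n⇒m≤pred[n] 1+k<n)
        | substAt-var> {pred n} {k} V (ℕₚ.suc[m]≤n⇒m≤pred[n] 1+k<n) = refl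
substAt-comm cW cV k (lam M) rewrite shift-Closed cW | shift-Closed cV =
  cong lam (substAt-comm cW cV (suc k) M)
substAt-comm cW cV k (app M N)  = cong₂ app (substAt-comm cW cV k M) (substAt-comm cW cV k N)
substAt-comm cW cV k (pair M N) = cong₂ pair (substAt-comm cW cV k M) (substAt-comm cW cV k N)
substAt-comm cW cV k (M ⊕ N)    = cong₂ _⊕_ (substAt-comm cW cV k M) (substAt-comm cW cV k N)
substAt-comm cW cV k π₁         = refl
substAt-comm cW cV k π₂         = refl
substAt-comm cW cV k rec        = refl
substAt-comm cW cV k zer        = refl
substAt-comm cW cV k suc′       = refl

-- substMany k (v₀ ∷ v₁ ∷ …) M substitutes v₀ for index k, then v₁ for the index that has
-- meanwhile moved down to k, and so on: a simultaneous substitution for k, k+1, ….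
substMany : ℕ → List Tm → Tm → Tm
substMany k []       M = M
substMany k (v ∷ vs) M = substMany k vs (substAt k v M)

substMany-lam : ∀ {k vs} M → All Closed vs → substMany k vs (lam M) ≡ lam (substMany (suc k) vs M)
substMany-lam M [] = refl
substMany-lam {k} {v ∷ vs} M (cv ∷ cvs) rewrite shift-Closed cv = substMany-lam (substAt (suc k) v M) cvs

substMany-app : ∀ k vs M N → substMany k vs (app M N) ≡ app (substMany k vs M) (substMany k vs N)
substMany-app k []       M N = refl
substMany-app k (v ∷ vs) M N = substMany-app k vs _ _

substMany-pair : ∀ k vs M N → substMany k vs (pair M N) ≡ pair (substMany k vs M) (substMany k vs N)
substMany-pair k []       M N = refl
substMany-pair k (v ∷ vs) M N = substMany-pair k vs _ _

substMany-⊕ : ∀ k vs M N → substMany k vs (M ⊕ N) ≡ (substMany k vs M ⊕ substMany k vs N)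
substMany-⊕ k []       M N = refl
substMany-⊕ k (v ∷ vs) M N = substMany-⊕ k vs _ _

substMany-Closed : ∀ k vs {M} → Closed M → substMany k vs M ≡ M
substMany-Closed k []       cM = refl
substMany-Closed k (v ∷ vs) cM rewrite substAt-Closed {k} v cM = substMany-Closed k vs cM

substAt-substMany : ∀ {k vs W} M → All Closed vs → Closed W →
                    substAt k W (substMany (suc k) vs M) ≡ substMany k vs (substAt k W M)
substAt-substMany M [] cW = refl
substAt-substMany {k} {v ∷ vs} M (cv ∷ cvs) cW =
  trans (substAt-substMany (substAt (suc k) v M) cvs cW) (cong (substMany k vs) (substAt-comm cW cv k M))

substMany-Scoped : ∀ {k vs M} → All Closed vs → Scoped (k + length vs) M → Scoped k (substMany k vs M)
substMany-Scoped {k} {[]} [] s rewrite ℕₚ.+-identityʳ k = s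
substMany-Scoped {k} {v ∷ vs} (cv ∷ cvs) s rewrite ℕₚ.+-suc k (length vs) =
  substMany-Scoped cvs (Scoped-substAt (ℕₚ.m≤m+n k (length vs)) cv s)

∋⇒< : ∀ {Γ n σ} → Γ ∋ n ∶ σ → n < length Γ
∋⇒< here      = s≤s z≤n
∋⇒< (there x) = s≤s (∋⇒< x)

⊢⇒Scoped : ∀ {Γ M σ} → Γ ⊢ M ∶ σ → Scoped (length Γ) M
⊢⇒Scoped (⊢var x)     = var (∋⇒< x)
⊢⇒Scoped (⊢lam d)     = lam (⊢⇒Scoped d)
⊢⇒Scoped (⊢app d e)   = app (⊢⇒Scoped d) (⊢⇒Scoped e)
⊢⇒Scoped (⊢pair d e)  = pair (⊢⇒Scoped d) (⊢⇒Scoped e)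
⊢⇒Scoped (⊢⊕ d e)     = ⊢⇒Scoped d ⊕ ⊢⇒Scoped e
⊢⇒Scoped ⊢π₁          = π₁
⊢⇒Scoped ⊢π₂          = π₂
⊢⇒Scoped ⊢rec         = rec
⊢⇒Scoped ⊢zer         = zer
⊢⇒Scoped ⊢suc         = suc′

Value : Tm → Set
Value M = isValue M ≡ true

∧-true⁻ : ∀ {a b} → (a ∧ b) ≡ true → a ≡ true × b ≡ true
∧-true⁻ {true} b≡true = refl , b≡true

value⇒irreducible : ∀ M → Value M → step M ≡ nothing
value⇒irreducible (lam M)     _ = refl
value⇒irreducible π₁          _ = refl
value⇒irreducible π₂          _ = refl
value⇒irreducible rec         _ = refl
value⇒irreducible zer         _ = refl
value⇒irreducible suc′        _ = refl
value⇒irreducible (app suc′ V) vV rewrite vV = refl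
value⇒irreducible (pair U V) vUV with ∧-true⁻ {isValue U} vUV
... | vU , vV rewrite vU = cong (mapM (pair U)) (value⇒irreducible V vV)
value⇒irreducible (var x) ()
value⇒irreducible (M ⊕ N) ()
value⇒irreducible (app (var x) N) ()
value⇒irreducible (app (lam M) N) ()
value⇒irreducible (app (app M M′) N) ()
value⇒irreducible (app (pair M M′) N) ()
value⇒irreducible (app π₁ N) ()
value⇒irreducible (app π₂ N) ()
value⇒irreducible (app rec N) ()
value⇒irreducible (app zer N) ()
value⇒irreducible (app (M ⊕ M′) N) ()

reducible⇒¬value : ∀ {M ν} → step M ≡ just ν → isValue M ≡ false
reducible⇒¬value {M} M→ν with isValue M in vM
... | false = refl
... | true with () ← trans (sym M→ν) (value⇒irreducible M vM)

step-app-values : ∀ {F U} → Value F → Value U → step (app F U) ≡ redex F U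
step-app-values vF vU rewrite vF | vU = refl

ReductionContext : (Tm → Tm) → Set
ReductionContext C = ∀ X {ν} → step X ≡ just ν → step (C X) ≡ just (push C ν)

app-argument-context : ∀ F → ReductionContext (app F)
app-argument-context F X X→ν rewrite reducible⇒¬value {X} X→ν | X→ν = refl

app-function-context : ∀ U → Value U → ReductionContext (λ X → app X U)
app-function-context U vU X X→ν rewrite vU | reducible⇒¬value {X} X→ν | X→ν = refl

pair-left-context : ∀ N → ReductionContext (λ X → pair X N)
pair-left-context N X X→ν rewrite reducible⇒¬value {X} X→ν | X→ν = refl

pair-right-context : ∀ U → Value U → ReductionContext (pair U)
pair-right-context U vU X X→ν rewrite vU | X→ν = refl

OnSupport : (Tm → Set) → Dist → Set
OnSupport P ν = All (P ∘ proj₁) ν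

-- Being inductive, Normalises P M asserts that the whole reduction tree of M is finite.
data Normalises (P : Tm → Set) : Tm → Set where
  value   : ∀ {M} → Value M → P M → Normalises P M
  reduces : ∀ {M ν} → step M ≡ just ν → OnSupport (Normalises P) ν → Normalises P M

reduces-to : ∀ {P M N} → step M ≡ just (dirac N) → Normalises P N → Normalises P M
reduces-to M→N n = reduces M→N (n ∷ [])

module _ {P Q : Tm → Set} {C : Tm → Tm} (context : ReductionContext C)
         (continue : ∀ {W} → Value W → P W → Normalises Q (C W)) where

  mutual
    Normalises-under : ∀ {M} → Normalises P M → Normalises Q (C M)
    Normalises-under     (value vM p)    = continue vM p
    Normalises-under {M} (reduces M→ν n) = reduces (context M M→ν) (Normalises-under* n)

    Normalises-under* : ∀ {ν} → OnSupport (Normalises P) ν → OnSupport (Normalises Q) (push C ν)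
    Normalises-under* []       = []
    Normalises-under* (n ∷ ns) = Normalises-under n ∷ Normalises-under* ns

-- Reducibility

data Numeral : Tm → Set where
  zer  : Numeral zer
  suc′ : ∀ {n} → Numeral n → Numeral (app suc′ n)

Reducible : Ty → Tm → Set
Reducible nat     W = Numeral W
Reducible (σ ⇒ τ) F =
  Closed F × Value F × (∀ U → Reducible σ U → Normalises (Reducible τ) (app F U))
Reducible (σ ⊗ τ) W = ∃₂ λ U V → W ≡ pair U V × Reducible σ U × Reducible τ V

Numeral⇒Value : ∀ {n} → Numeral n → Value n
Numeral⇒Value zer      = refl
Numeral⇒Value (suc′ n) = Numeral⇒Value n

Numeral⇒Closed : ∀ {n} → Numeral n → Closed n
Numeral⇒Closed zer      = zer
Numeral⇒Closed (suc′ n) = app suc′ (Numeral⇒Closed n)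

pair-Value : ∀ U V → Value U → Value V → Value (pair U V)
pair-Value U V vU vV rewrite vU = vV

Reducible⇒Value : ∀ σ {W} → Reducible σ W → Value W
Reducible⇒Value nat     n                      = Numeral⇒Value n
Reducible⇒Value (σ ⇒ τ) (_ , vF , _)           = vF
Reducible⇒Value (σ ⊗ τ) (U , V , refl , u , v) =
  pair-Value U V (Reducible⇒Value σ u) (Reducible⇒Value τ v)

Reducible⇒Closed : ∀ σ {W} → Reducible σ W → Closed W
Reducible⇒Closed nat     n                      = Numeral⇒Closed n
Reducible⇒Closed (σ ⇒ τ) (cF , _ , _)           = cF
Reducible⇒Closed (σ ⊗ τ) (_ , _ , refl , u , v) =
  pair (Reducible⇒Closed σ u) (Reducible⇒Closed τ v)

Reducible⇒Normalises : ∀ σ {W} → Reducible σ W → Normalises (Reducible σ) W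
Reducible⇒Normalises σ w = value (Reducible⇒Value σ w) w

app-Normalises : ∀ {σ τ F U} → Normalises (Reducible (σ ⇒ τ)) F → Normalises (Reducible σ) U →
                 Normalises (Reducible τ) (app F U)
app-Normalises {σ} {τ} {F} nF nU = Normalises-under (app-argument-context F) apply-to nU
  where
  apply-to : ∀ {U} → Value U → Reducible σ U → Normalises (Reducible τ) (app F U)
  apply-to {U} vU u = Normalises-under (app-function-context U vU) (λ _ (_ , _ , f) → f _ u) nF

pair-Normalises : ∀ {σ τ M N} → Normalises (Reducible σ) M → Normalises (Reducible τ) N →
                  Normalises (Reducible (σ ⊗ τ)) (pair M N)
pair-Normalises {σ} {τ} {N = N} nM nN = Normalises-under (pair-left-context N) pair-with nM
  where
  pair-with : ∀ {U} → Value U → Reducible σ U → Normalises (Reducible (σ ⊗ τ)) (pair U N)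
  pair-with {U} vU u = Normalises-under (pair-right-context U vU) pair-value nN
    where
    pair-value : ∀ {V} → Value V → Reducible τ V → Normalises (Reducible (σ ⊗ τ)) (pair U V)
    pair-value {V} vV v = value (pair-Value U V vU vV) (U , V , refl , u , v)

triple-Value : ∀ σ {U V n} → Reducible σ U → Reducible (nat ⇒ σ ⇒ σ) V → Numeral n →
               Value (triple U V n)
triple-Value σ {U} {V} {n} u (_ , vV , _) n′ =
  pair-Value U (pair V n) (Reducible⇒Value σ u) (pair-Value V n vV (Numeral⇒Value n′))

rec-Normalises : ∀ σ {U V n} → Reducible σ U → Reducible (nat ⇒ σ ⇒ σ) V → Numeral n →
                 Normalises (Reducible σ) (app rec (triple U V n))
rec-Normalises σ {U} {V} u v zer =
  reduces-to (step-app-values {rec} {triple U V zer} refl (triple-Value σ u v zer))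
             (Reducible⇒Normalises σ u)
rec-Normalises σ {U} {V} u v@(_ , _ , f) (suc′ {n} n′) =
  reduces-to (step-app-values {rec} {triple U V (app suc′ n)} refl (triple-Value σ u v (suc′ n′)))
             (app-Normalises (f _ n′) (rec-Normalises σ u v n′))

π₁-Reducible : ∀ {σ τ} → Reducible ((σ ⊗ τ) ⇒ σ) π₁
π₁-Reducible {σ} {τ} = π₁ , refl , λ { _ w@(U , V , refl , u , _) →
  reduces-to (step-app-values {π₁} {pair U V} refl (Reducible⇒Value (σ ⊗ τ) w))
             (Reducible⇒Normalises σ u) }

π₂-Reducible : ∀ {σ τ} → Reducible ((σ ⊗ τ) ⇒ τ) π₂
π₂-Reducible {σ} {τ} = π₂ , refl , λ { _ w@(U , V , refl , _ , v) →
  reduces-to (step-app-values {π₂} {pair U V} refl (Reducible⇒Value (σ ⊗ τ) w))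
             (Reducible⇒Normalises τ v) }

rec-Reducible : ∀ {σ} → Reducible ((σ ⊗ ((nat ⇒ σ ⇒ σ) ⊗ nat)) ⇒ σ) rec
rec-Reducible {σ} = rec , refl , λ { _ (_ , _ , refl , u , (_ , _ , refl , v , n)) →
  rec-Normalises σ u v n }

suc-Reducible : Reducible (nat ⇒ nat) suc′
suc-Reducible = suc′ , refl , λ _ n → value (Numeral⇒Value n) (suc′ n)

data ReducibleEnv : Ctx → List Tm → Set where
  []  : ReducibleEnv [] []
  _∷_ : ∀ {σ Γ v vs} → Reducible σ v → ReducibleEnv Γ vs → ReducibleEnv (σ ∷ Γ) (v ∷ vs)

ReducibleEnv⇒Closed : ∀ {Γ vs} → ReducibleEnv Γ vs → All Closed vs
ReducibleEnv⇒Closed []            = []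
ReducibleEnv⇒Closed (_∷_ {σ} v ρ) = Reducible⇒Closed σ v ∷ ReducibleEnv⇒Closed ρ

ReducibleEnv-length : ∀ {Γ vs} → ReducibleEnv Γ vs → length vs ≡ length Γ
ReducibleEnv-length []      = refl
ReducibleEnv-length (_ ∷ ρ) = cong suc (ReducibleEnv-length ρ)

ReducibleEnv-lookup : ∀ {Γ n σ vs} → Γ ∋ n ∶ σ → ReducibleEnv Γ vs →
                      Reducible σ (substMany 0 vs (var n))
ReducibleEnv-lookup {σ = σ} {v ∷ vs} here (v′ ∷ _)
  rewrite substMany-Closed 0 vs (Reducible⇒Closed σ v′) = v′
ReducibleEnv-lookup (there x) (_ ∷ ρ) = ReducibleEnv-lookup x ρ

constant-Normalises : ∀ {P c} vs → Closed c → Normalises P c → Normalises P (substMany 0 vs c)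
constant-Normalises {P} vs cc = subst (Normalises P) (sym (substMany-Closed 0 vs cc))

fundamental : ∀ {Γ M σ vs} → Γ ⊢ M ∶ σ → ReducibleEnv Γ vs →
              Normalises (Reducible σ) (substMany 0 vs M)
fundamental {σ = σ} (⊢var x) ρ = Reducible⇒Normalises σ (ReducibleEnv-lookup x ρ)
fundamental {M = lam M} {σ ⇒ τ} {vs} (⊢lam d) ρ
  rewrite substMany-lam {0} {vs} M (ReducibleEnv⇒Closed ρ) =
  value refl (lam body-Scoped , refl , λ U u →
    reduces-to (step-app-values {lam (substMany 1 vs M)} {U} refl (Reducible⇒Value σ u))
               (subst (Normalises (Reducible τ)) (sym (β-substMany u)) (fundamental d (u ∷ ρ))))
  where
  body-Scoped : Scoped 1 (substMany 1 vs M)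
  body-Scoped = substMany-Scoped (ReducibleEnv⇒Closed ρ)
                  (subst (λ l → Scoped (suc l) M) (sym (ReducibleEnv-length ρ)) (⊢⇒Scoped d))
  β-substMany : ∀ {U} → Reducible σ U → substAt 0 U (substMany 1 vs M) ≡ substMany 0 (U ∷ vs) M
  β-substMany u = substAt-substMany M (ReducibleEnv⇒Closed ρ) (Reducible⇒Closed σ u)
fundamental {M = app M N} {vs = vs} (⊢app d e) ρ rewrite substMany-app 0 vs M N =
  app-Normalises (fundamental d ρ) (fundamental e ρ)
fundamental {M = pair M N} {vs = vs} (⊢pair d e) ρ rewrite substMany-pair 0 vs M N =
  pair-Normalises (fundamental d ρ) (fundamental e ρ)
fundamental {M = M ⊕ N} {vs = vs} (⊢⊕ d e) ρ rewrite substMany-⊕ 0 vs M N =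
  reduces refl (fundamental d ρ ∷ fundamental e ρ ∷ [])
fundamental {vs = vs} ⊢π₁  _ = constant-Normalises vs π₁ (value refl π₁-Reducible)
fundamental {vs = vs} ⊢π₂  _ = constant-Normalises vs π₂ (value refl π₂-Reducible)
fundamental {vs = vs} ⊢rec _ = constant-Normalises vs rec (value refl rec-Reducible)
fundamental {vs = vs} ⊢zer _ = constant-Normalises vs zer (value refl zer)
fundamental {vs = vs} ⊢suc _ = constant-Normalises vs suc′ (value refl suc-Reducible)

-- Stabilisation of the distributions μ_k

data HaltsWithin : ℕ → Tm → Set where
  stuck   : ∀ {d M} → step M ≡ nothing → HaltsWithin d M
  reduces : ∀ {d M ν} → step M ≡ just ν → OnSupport (HaltsWithin d) ν → HaltsWithin (suc d) M

mutual
  HaltsWithin-mono : ∀ {d e M} → d ≤ e → HaltsWithin d M → HaltsWithin e M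
  HaltsWithin-mono d≤e       (stuck M↛)      = stuck M↛
  HaltsWithin-mono (s≤s d≤e) (reduces M→ν h) = reduces M→ν (HaltsWithin-mono* d≤e h)

  HaltsWithin-mono* : ∀ {d e ν} → d ≤ e →
                      OnSupport (HaltsWithin d) ν → OnSupport (HaltsWithin e) ν
  HaltsWithin-mono* d≤e []       = []
  HaltsWithin-mono* d≤e (h ∷ hs) = HaltsWithin-mono d≤e h ∷ HaltsWithin-mono* d≤e hs

mutual
  Normalises⇒HaltsWithin : ∀ {P M} → Normalises P M → ∃ λ d → HaltsWithin d M
  Normalises⇒HaltsWithin {M = M} (value vM _) = 0 , stuck (value⇒irreducible M vM)
  Normalises⇒HaltsWithin (reduces M→ν n) with Normalises⇒HaltsWithin* n
  ... | d , h = suc d , reduces M→ν h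

  Normalises⇒HaltsWithin* : ∀ {P ν} → OnSupport (Normalises P) ν →
                            ∃ λ d → OnSupport (HaltsWithin d) ν
  Normalises⇒HaltsWithin* [] = 0 , []
  Normalises⇒HaltsWithin* (n ∷ ns) with Normalises⇒HaltsWithin n | Normalises⇒HaltsWithin* ns
  ... | d , h | e , hs =
    d ⊔ e , HaltsWithin-mono (ℕₚ.m≤m⊔n d e) h ∷ HaltsWithin-mono* (ℕₚ.m≤n⊔m d e) hs

OnSupport-scale : ∀ {P : Tm → Set} p ν → OnSupport P ν → OnSupport P (scale p ν)
OnSupport-scale p []      []       = []
OnSupport-scale p (_ ∷ ν) (h ∷ hs) = h ∷ OnSupport-scale p ν hs

stepD-HaltsWithin : ∀ {d} ξ → OnSupport (HaltsWithin (suc d)) ξ → OnSupport (HaltsWithin d) (stepD ξ)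
stepD-HaltsWithin []            []       = []
stepD-HaltsWithin ((M , p) ∷ ξ) (h ∷ hs) with step M in M→ | h
... | nothing | _                = stuck M→ ∷ stepD-HaltsWithin ξ hs
... | just ν  | stuck M↛        with () ← trans (sym M↛) M→
... | just ν  | reduces M→ν′ h′ =
  ++⁺ (OnSupport-scale p ν (subst (OnSupport _) (just-injective (trans (sym M→ν′) M→)) h′))
      (stepD-HaltsWithin ξ hs)

stepD-fixes : ∀ ξ → OnSupport (HaltsWithin 0) ξ → stepD ξ ≡ ξ
stepD-fixes []            []       = refl
stepD-fixes ((M , p) ∷ ξ) (h ∷ hs) with step M in M→ | h
... | nothing | _         = cong ((M , p) ∷_) (stepD-fixes ξ hs)
... | just ν  | stuck M↛ with () ← trans (sym M↛) M→

μ-HaltsWithin : ∀ M k {d} → HaltsWithin (k + d) M → OnSupport (HaltsWithin d) (μ M k)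
μ-HaltsWithin M zero    h = h ∷ []
μ-HaltsWithin M (suc k) {d} h =
  stepD-HaltsWithin (μ M k) (μ-HaltsWithin M k (subst (flip HaltsWithin M) (sym (ℕₚ.+-suc k d)) h))

μ-stable : ∀ {M D} → HaltsWithin D M → ∀ j → μ M (j + D) ≡ μ M D
μ-stable h zero = refl
μ-stable {M} {D} h (suc j) = begin
  stepD (μ M (j + D)) ≡⟨ cong stepD (μ-stable h j) ⟩
  stepD (μ M D)       ≡⟨ stepD-fixes (μ M D) (μ-HaltsWithin M D h′) ⟩
  μ M D               ∎
  where
  open ≡-Reasoning
  h′ : HaltsWithin (D + 0) M
  h′ = subst (flip HaltsWithin M) (sym (ℕₚ.+-identityʳ D)) h

avPartial-suc-constant : ∀ M n → μ M (suc n) ≡ μ M n → avPartial M (suc n) ≡ avPartial M n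
avPartial-suc-constant M n μ-fixed = begin
  avPartial M n ℚ.+ k ℚ.* (valMass (μ M (suc n)) ℚ.- valMass (μ M n))
    ≡⟨ cong (λ ν → avPartial M n ℚ.+ k ℚ.* (valMass ν ℚ.- valMass (μ M n))) μ-fixed ⟩
  avPartial M n ℚ.+ k ℚ.* (valMass (μ M n) ℚ.- valMass (μ M n))
    ≡⟨ cong (λ x → avPartial M n ℚ.+ k ℚ.* x) (ℚₚ.+-inverseʳ (valMass (μ M n))) ⟩
  avPartial M n ℚ.+ k ℚ.* ℚ.0ℚ
    ≡⟨ cong (avPartial M n ℚ.+_) (ℚₚ.*-zeroʳ k) ⟩
  avPartial M n ℚ.+ ℚ.0ℚ
    ≡⟨ ℚₚ.+-identityʳ (avPartial M n) ⟩
  avPartial M n ∎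
  where
  open ≡-Reasoning
  k = (+ suc n) ℚ./ 1

avPartial-stable : ∀ {M D} → HaltsWithin D M → ∀ j → avPartial M (j + D) ≡ avPartial M D
avPartial-stable h zero = refl
avPartial-stable {M} {D} h (suc j) =
  trans (avPartial-suc-constant M (j + D) (trans (μ-stable h (suc j)) (sym (μ-stable h j))))
        (avPartial-stable h j)

toℚ : ℕ → ℚ
toℚ n = (+ n) ℚ./ 1

toℚ≡mkℚ : ∀ n → toℚ n ≡ mkℚ (+ n) 0 (Coprimality.sym (Coprimality.1-coprimeTo n))
toℚ≡mkℚ n = ℚₚ.normalize-coprime (Coprimality.sym (Coprimality.1-coprimeTo n))

toℚ-mono-≤ : ∀ {m n} → m ≤ n → toℚ m ℚ.≤ toℚ n
toℚ-mono-≤ {m} {n} m≤n rewrite toℚ≡mkℚ m | toℚ≡mkℚ n =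
  *≤* (subst₂ ℤ._≤_ (sym (ℤₚ.*-identityʳ (+ m))) (sym (ℤₚ.*-identityʳ (+ n))) (+≤+ m≤n))

≤-toℚ-∣numerator∣ : ∀ q → q ℚ.≤ toℚ ∣ ↥ q ∣
≤-toℚ-∣numerator∣ (mkℚ i d _) rewrite toℚ≡mkℚ ∣ i ∣ =
  *≤* (subst (ℤ._≤ + ∣ i ∣ ℤ.* + suc d) (sym (ℤₚ.*-identityʳ i)) (≤-∣i∣*denominator i))
  where
  ≤-∣i∣*denominator : ∀ i → i ℤ.≤ + ∣ i ∣ ℤ.* + suc d
  ≤-∣i∣*denominator (+ n) rewrite sym (ℤₚ.pos-* n (suc d)) = +≤+ (ℕₚ.m≤m*n n (suc d))
  ≤-∣i∣*denominator -[1+ n ] = -≤+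

maxUpTo : (ℕ → ℕ) → ℕ → ℕ
maxUpTo g zero    = g zero
maxUpTo g (suc D) = maxUpTo g D ⊔ g (suc D)

≤-maxUpTo : ∀ g {n D} → n ≤ D → g n ≤ maxUpTo g D
≤-maxUpTo g {zero}  {zero}  _ = ℕₚ.≤-refl
≤-maxUpTo g {suc n} {zero}  ()
≤-maxUpTo g {n}     {suc D} n≤1+D with ℕₚ.m≤n⇒m<n∨m≡n n≤1+D
... | inj₁ (s≤s n≤D) = ℕₚ.≤-trans (≤-maxUpTo g n≤D) (ℕₚ.m≤m⊔n (maxUpTo g D) (g (suc D)))
... | inj₂ refl      = ℕₚ.m≤n⊔m (maxUpTo g D) (g (suc D))

eventually-constant⇒bounded : ∀ (f : ℕ → ℚ) D → (∀ j → f (j + D) ≡ f D) →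
                              ∃ λ B → ∀ n → f n ℚ.≤ toℚ B
eventually-constant⇒bounded f D f-const = B , f≤B
  where
  ∣↥f∣ : ℕ → ℕ
  ∣↥f∣ n = ∣ ↥ f n ∣

  B : ℕ
  B = maxUpTo ∣↥f∣ D

  f≤B-upTo : ∀ {n} → n ≤ D → f n ℚ.≤ toℚ B
  f≤B-upTo {n} n≤D = ℚₚ.≤-trans (≤-toℚ-∣numerator∣ (f n)) (toℚ-mono-≤ (≤-maxUpTo ∣↥f∣ n≤D))

  f≤B : ∀ n → f n ℚ.≤ toℚ B
  f≤B n with ℕₚ.≤-total n D
  ... | inj₁ n≤D = f≤B-upTo n≤D
  ... | inj₂ D≤n = subst (ℚ._≤ toℚ B) (sym f[n]≡f[D]) (f≤B-upTo ℕₚ.≤-refl)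
    where
    f[n]≡f[D] : f n ≡ f D
    f[n]≡f[D] = trans (cong f (sym (ℕₚ.m∸n+n≡m D≤n))) (f-const (n ∸ D))

mainTheorem4 : (M : Tm) (σ : Ty) → [] ⊢ M ∶ σ → AvLengthFinite M
mainTheorem4 M σ ⊢M with Normalises⇒HaltsWithin (fundamental {vs = []} ⊢M [])
... | D , halts = eventually-constant⇒bounded (avPartial M) D (avPartial-stable halts)
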